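{- For every positive integer $r$ there exist simple nontrivial connected graphs $G_1,G_2,G_3,G_4$ such that $\gamma'(G_1)-\gamma(G_1)>r$, $\gamma(G_2)-\gamma'(G_2)>r$, $\gamma_{V,E}(G_3)-\gamma_{E,V}(G_3)>r$, and $\gamma_{E,V}(G_4)-\gamma_{V,E}(G_4)>r$.
   Context: An element of a graph $G=(V,E)$ is a member of $V\cup E$. Two different elements are associated if they are adjacent (two adjacent vertices, or two edges sharing an end-vertex) or incident (a vertex and an edge containing it). For $U,W\in\{V,E,V\cup E\}$, a subset $A\subseteq U$ dominates $W$ if every element of $W\setminus(A\cap W)$ is associated with some element of $A$; $\gamma_{U,W}(G)$ denotes the minimum cardinality of a subset $A\subseteq U$ dominating $W$. Notation: $\gamma(G)=\gamma_{V,V}(G)$, $\gamma'(G)=\gamma_{E,E}(G)$. -}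

module Defs where

open import Data.Nat using (ℕ; _≤_; _<_)
open import Data.Fin using (Fin; toℕ)
open import Data.Bool using (Bool; true)
open import Data.Empty using (⊥)
open import Data.Unit using (⊤)
open import Data.Product using (Σ; ∃; _×_; _,_)
open import Data.Sum using (_⊎_)
open import Data.List using (List; length)
open import Data.List.Relation.Unary.All using (All)
open import Data.List.Relation.Unary.Any using (Any)
open import Data.List.Relation.Unary.Unique.Propositional using (Unique)
open import Data.List.Membership.Propositional using (_∈_)
open import Relation.Binary.PropositionalEquality using (_≡_; _≢_)

record Graph : Set where
  field
    n      : ℕ
    adj    : Fin n → Fin n → Bool
    sym    : ∀ u v → adj u v ≡ true → adj v u ≡ true
    irrefl : ∀ v → adj v v ≡ true → ⊥

open Graph public

data Elem (n : ℕ) : Set where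
  vtx : Fin n → Elem n
  edg : Fin n → Fin n → Elem n

-- The edge {i,j} is represented uniquely as edg i j with toℕ i < toℕ j.
IsEdge : (G : Graph) → Fin (n G) → Fin (n G) → Set
IsEdge G i j = (toℕ i < toℕ j) × (adj G i j ≡ true)

data Kind : Set where
  V E VE : Kind

InKind : (G : Graph) → Kind → Elem (n G) → Set
InKind G V  (vtx v)   = ⊤
InKind G V  (edg i j) = ⊥
InKind G E  (vtx v)   = ⊥
InKind G E  (edg i j) = IsEdge G i j
InKind G VE (vtx v)   = ⊤
InKind G VE (edg i j) = IsEdge G i j

Associated : (G : Graph) → Elem (n G) → Elem (n G) → Set
Associated G (vtx u)   (vtx v)   = adj G u v ≡ true
Associated G (vtx u)   (edg i j) = (u ≡ i) ⊎ (u ≡ j)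
Associated G (edg i j) (vtx u)   = (u ≡ i) ⊎ (u ≡ j)
Associated G (edg i j) (edg k l) =
  (edg {n G} i j ≢ edg k l) × ((i ≡ k) ⊎ (i ≡ l) ⊎ (j ≡ k) ⊎ (j ≡ l))

-- A finite subset of U(G), represented as a duplicate-free list of elements of U(G);
-- its cardinality is the length of the list.
IsSubsetOf : (G : Graph) → Kind → List (Elem (n G)) → Set
IsSubsetOf G U A = All (InKind G U) A × Unique A

Dominates : (G : Graph) → List (Elem (n G)) → Kind → Set
Dominates G A W = ∀ x → InKind G W x → (x ∈ A) ⊎ Any (λ a → Associated G a x) A

IsDomNum : (G : Graph) → Kind → Kind → ℕ → Set
IsDomNum G U W k =
  (Σ (List (Elem (n G))) λ A → IsSubsetOf G U A × Dominates G A W × length A ≡ k)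
  × (∀ A → IsSubsetOf G U A → Dominates G A W → k ≤ length A)

data Reachable (G : Graph) : Fin (n G) → Fin (n G) → Set where
  here : ∀ {v} → Reachable G v v
  step : ∀ {u v w} → adj G u v ≡ true → Reachable G v w → Reachable G u w

Connected : Graph → Set
Connected G = ∀ u v → Reachable G u v

Nontrivial : Graph → Set
Nontrivial G = 2 ≤ n G

-- The witnesses are
--   * the friendship graph (m triangles sharing an apex):    γ = 1,  γ' = m;
--   * the corona of K_{2k} (a pendant vertex at each clique vertex): γ = 2k, γ' = k;
--   * the complete graph K_{2m}: γ_{V,E} = 2m − 1 (vertex cover), γ_{E,V} = m;
--   * the star K_{1,m}:          γ_{V,E} = 1,  γ_{E,V} = m.
-- Upper bounds are explicit dominating sets.  Most lower bounds come from one
-- counting principle, a "tagging": if each element of U carries at most c of m tags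
-- and each tag i has a target in W dominated only by elements tagged i, then every
-- dominating set has at least m / c elements (a pigeonhole argument on positions).
-- The others are "a nonempty W needs a dominator" and the vertex-cover bound for
-- complete graphs (all vertices but one, by pigeonhole through punchIn).
module Submission where

open import Defs hiding (sym)
open import Data.Nat using (ℕ; zero; suc; _+_; _*_; _<_; _≤_; z≤n; s≤s)
open import Data.Nat.Properties
  using (≤-refl; ≤-trans; ≤-reflexive; n≤1+n; m≤m+n; +-suc; +-mono-≤; +-monoʳ-<;
         n<1+n; *-suc; *-identityˡ; *-cancelˡ-≤; +-identityʳ; module ≤-Reasoning)
open import Data.Fin using (Fin; zero; suc; toℕ; _↑ˡ_; _↑ʳ_; splitAt; punchIn; _≟_)
open import Data.Fin.Properties
  using (toℕ-↑ˡ; toℕ-↑ʳ; toℕ<n; ↑ˡ-injective; splitAt-↑ˡ; splitAt-↑ʳ; splitAt⁻¹-↑ˡ;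
         splitAt⁻¹-↑ʳ; punchIn-injective; punchInᵢ≢i; injective⇒≤; all?; ¬∀⟶∃¬; <-cmp)
  renaming (<⇒≢ to <⇒≢ᶠ)
open import Data.Bool using (Bool; true; false; not; _∧_; _∨_)
open import Data.Bool.Properties using (∧-comm; ∧-zeroʳ; ∨-zeroʳ)
open import Data.Product using (Σ; ∃; _×_; _,_; proj₁)
open import Data.Sum using (_⊎_; inj₁; inj₂; [_,_]′)
import Data.Sum as Sum
open import Data.Empty using (⊥; ⊥-elim)
open import Data.Unit using (tt)
open import Data.List using (List; []; _∷_; [_]; length; map; tabulate; concatMap; lookup; allFin; _++_)
open import Data.List.Properties using (length-map; length-tabulate; length-++)
open import Data.List.Relation.Unary.All using (All; []; _∷_)
import Data.List.Relation.Unary.All as All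
open import Data.List.Relation.Unary.All.Properties
  using () renaming (map⁺ to all-map⁺; tabulate⁺ to all-tabulate⁺)
open import Data.List.Relation.Unary.Any using (Any; here; there)
import Data.List.Relation.Unary.Any as Any
open import Data.List.Relation.Unary.Any.Properties using (lookup-index)
open import Data.List.Relation.Unary.AllPairs using ([]; _∷_)
open import Data.List.Relation.Unary.Unique.Propositional using (Unique)
open import Data.List.Relation.Unary.Unique.Propositional.Properties
  using () renaming (map⁺ to unique-map⁺; tabulate⁺ to unique-tabulate⁺; allFin⁺ to unique-allFin⁺)
open import Data.List.Membership.Propositional using (_∈_; find; lose)
open import Data.List.Membership.Propositional.Properties
  using (∈-map⁺; ∈-tabulate⁺; ∈-allFin; ∈-concatMap⁺)
import Data.List.Membership.DecPropositional as DecMembership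
open import Function using (id; _∘_)
open import Function.Bundles using (mk⇔)
open import Relation.Binary.Definitions using (tri<; tri≈; tri>)
open import Relation.Binary.PropositionalEquality
  using (_≡_; _≢_; refl; sym; trans; cong; cong₂; subst; subst₂; module ≡-Reasoning)
open import Relation.Nullary using (Dec; yes; no; does)
open import Relation.Nullary.Decidable using (dec-true; dec-false; does-⇔; map′; _×-dec_)

private
  variable
    k m c : ℕ
    G : Graph

-- Pigeonhole: if m pairwise distinct values all occur in L, then L has at least
-- m entries (send each value to the position where it occurs).
injection-into-list : {X : Set} {L : List X} (f : Fin m → X) →
  (∀ {i j} → f i ≡ f j → i ≡ j) → (∀ i → f i ∈ L) → m ≤ length L
injection-into-list {L = L} f f-injective occurs = injective⇒≤ position-injective
  where
  position : Fin _ → Fin (length L)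
  position i = Any.index (occurs i)

  position-injective : ∀ {i j} → position i ≡ position j → i ≡ j
  position-injective {i} {j} same = f-injective (begin
    f i                   ≡⟨ lookup-index (occurs i) ⟩
    lookup L (position i) ≡⟨ cong (lookup L) same ⟩
    lookup L (position j) ≡⟨ sym (lookup-index (occurs j)) ⟩
    f j                   ∎)
    where open ≡-Reasoning

length-concatMap-≤ : {X Y : Set} (tags : X → List Y) (A : List X) →
  All (λ a → length (tags a) ≤ c) A → length (concatMap tags A) ≤ c * length A
length-concatMap-≤ tags [] [] = z≤n
length-concatMap-≤ {c = c} tags (a ∷ A) (few ∷ fews) = begin
  length (tags a ++ concatMap tags A)         ≡⟨ length-++ (tags a) ⟩
  length (tags a) + length (concatMap tags A) ≤⟨ +-mono-≤ few (length-concatMap-≤ tags A fews) ⟩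
  c + c * length A                            ≡⟨ sym (*-suc c (length A)) ⟩
  c * suc (length A)                          ∎
  where open ≤-Reasoning

halve : m + m ≤ 2 * k → m ≤ k
halve {m} {k} le = *-cancelˡ-≤ 2 (subst (_≤ 2 * k) (cong (m +_) (sym (+-identityʳ m))) le)

_==_ : Fin k → Fin k → Bool
i == j = does (i ≟ j)

==-sound : {i j : Fin k} → (i == j) ≡ true → i ≡ j
==-sound {i = i} {j} eq with i ≟ j
... | yes i≡j = i≡j
==-sound () | no _

==-sym : {i j : Fin k} → (i == j) ≡ (j == i)
==-sym {i = i} {j} = does-⇔ (mk⇔ sym sym) (i ≟ j) (j ≟ i)

∧-trueˡ : ∀ a {b} → a ∧ b ≡ true → a ≡ true
∧-trueˡ true  _ = refl
∧-trueˡ false ()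

vtx-injective : {u v : Fin k} → vtx u ≡ vtx v → u ≡ v
vtx-injective refl = refl

edg-injective : {a b c d : Fin k} → edg a b ≡ edg c d → a ≡ c × b ≡ d
edg-injective refl = refl , refl

_≟ᴱ_ : (x y : Elem k) → Dec (x ≡ y)
vtx u   ≟ᴱ vtx v   = map′ (cong vtx) vtx-injective (u ≟ v)
vtx _   ≟ᴱ edg _ _ = no λ ()
edg _ _ ≟ᴱ vtx _   = no λ ()
edg a b ≟ᴱ edg c d =
  map′ (λ (a≡c , b≡d) → cong₂ edg a≡c b≡d) edg-injective ((a ≟ c) ×-dec (b ≟ d))

_∈ᴱ?_ : (x : Elem k) (A : List (Elem k)) → Dec (x ∈ A)
x ∈ᴱ? A = DecMembership._∈?_ _≟ᴱ_ x A

endpoints : Elem k → List (Fin k)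
endpoints (vtx v)   = [ v ]
endpoints (edg p q) = p ∷ q ∷ []

share-endpoint : {X : Set} {a b p q v : X} → a ≡ v ⊎ b ≡ v → p ≡ v ⊎ q ≡ v →
  (a ≡ p) ⊎ (a ≡ q) ⊎ (b ≡ p) ⊎ (b ≡ q)
share-endpoint (inj₁ refl) (inj₁ refl) = inj₁ refl
share-endpoint (inj₁ refl) (inj₂ refl) = inj₂ (inj₁ refl)
share-endpoint (inj₂ refl) (inj₁ refl) = inj₂ (inj₂ (inj₁ refl))
share-endpoint (inj₂ refl) (inj₂ refl) = inj₂ (inj₂ (inj₂ refl))

adjacent-distinct : {x y : Fin (n G)} → adj G x y ≡ true → x ≢ y
adjacent-distinct {G} h refl = irrefl G _ h

_▷_ : {u v w : Fin (n G)} → Reachable G u v → Reachable G v w → Reachable G u w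
here       ▷ q = q
step e p   ▷ q = step e (p ▷ q)

reverse : {u v : Fin (n G)} → Reachable G u v → Reachable G v u
reverse here                    = here
reverse {G} (step {u} {v} e p)  = reverse p ▷ step (Graph.sym G u v e) here

-- Dominating sets

Covers : (G : Graph) → Elem (n G) → Elem (n G) → Set
Covers G a x = (x ≡ a) ⊎ Associated G a x

dominator : {A : List (Elem (n G))} {W : Kind} {x : Elem (n G)} →
  Dominates G A W → InKind G W x → ∃ λ a → a ∈ A × Covers G a x
dominator dom x∈W = find ([ Any.map inj₁ , Any.map inj₂ ]′ (dom _ x∈W))

dominated-by : (G : Graph) {A : List (Elem (n G))} {a x : Elem (n G)} → a ∈ A →
  (a ≢ x → Associated G a x) → (x ∈ A) ⊎ Any (λ b → Associated G b x) A
dominated-by G {a = a} {x} a∈A associated with a ≟ᴱ x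
... | yes refl = inj₁ a∈A
... | no a≢x   = inj₂ (lose a∈A (associated a≢x))

dominating-nonempty : {A : List (Elem (n G))} {W : Kind} {x : Elem (n G)} →
  InKind G W x → Dominates G A W → 1 ≤ length A
dominating-nonempty {A = []} x∈W dom with dom _ x∈W
... | inj₁ ()
... | inj₂ ()
dominating-nonempty {A = _ ∷ _} _ _ = s≤s z≤n

record Tagging (G : Graph) (U W : Kind) (m c : ℕ) : Set where
  field
    target   : Fin m → Elem (n G)
    target∈W : ∀ i → InKind G W (target i)
    tags     : Elem (n G) → List (Fin m)
    few-tags : ∀ a → InKind G U a → length (tags a) ≤ c
    tagged   : ∀ i a → InKind G U a → Covers G a (target i) → i ∈ tags a

tagging-bound : {U W : Kind} → Tagging G U W m c →
  ∀ A → IsSubsetOf G U A → Dominates G A W → m ≤ c * length A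
tagging-bound {G} {m} {c} T A (A⊆U , _) dom =
  ≤-trans (injection-into-list id id every-tag-occurs)
          (length-concatMap-≤ tags A (All.map (λ {a} → few-tags a) A⊆U))
  where
  open Tagging T

  every-tag-occurs : ∀ i → i ∈ concatMap tags A
  every-tag-occurs i with dominator dom (target∈W i)
  ... | a , a∈A , covers =
    ∈-concatMap⁺ tags (lose a∈A (tagged i a (All.lookup A⊆U a∈A) covers))

tagging-bound₁ : {U W : Kind} → Tagging G U W m 1 →
  ∀ A → IsSubsetOf G U A → Dominates G A W → m ≤ length A
tagging-bound₁ T A sub dom = ≤-trans (tagging-bound T A sub dom) (≤-reflexive (*-identityˡ _))

left : Fin m → Fin (m + m)
left {m} i = i ↑ˡ m

right : Fin m → Fin (m + m)
right {m} i = m ↑ʳ i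

half : (m : ℕ) → Fin (m + m) → Fin m
half m x = [ id , id ]′ (splitAt m x)

isLeft : (m : ℕ) → Fin (m + m) → Bool
isLeft m x = [ (λ _ → true) , (λ _ → false) ]′ (splitAt m x)

half-left : (i : Fin m) → half m (left i) ≡ i
half-left {m} i = cong [ id , id ]′ (splitAt-↑ˡ m i m)

half-right : (i : Fin m) → half m (right i) ≡ i
half-right {m} i = cong [ id , id ]′ (splitAt-↑ʳ m m i)

isLeft-left : (i : Fin m) → isLeft m (left i) ≡ true
isLeft-left {m} i = cong [ (λ _ → true) , (λ _ → false) ]′ (splitAt-↑ˡ m i m)

isLeft-right : (i : Fin m) → isLeft m (right i) ≡ false
isLeft-right {m} i = cong [ (λ _ → true) , (λ _ → false) ]′ (splitAt-↑ʳ m m i)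

left<right : (i j : Fin m) → toℕ (left i) < toℕ (right j)
left<right {m} i j = begin-strict
  toℕ (i ↑ˡ m) ≡⟨ toℕ-↑ˡ i m ⟩
  toℕ i        <⟨ toℕ<n i ⟩
  m            ≤⟨ m≤m+n m (toℕ j) ⟩
  m + toℕ j    ≡⟨ sym (toℕ-↑ʳ m j) ⟩
  toℕ (m ↑ʳ j) ∎
  where open ≤-Reasoning

left≢right : (i j : Fin m) → left i ≢ right j
left≢right i j = <⇒≢ᶠ (left<right i j)

left-or-right : (m : ℕ) (x : Fin (m + m)) → x ≡ left (half m x) ⊎ x ≡ right (half m x)
left-or-right m x with splitAt m x in eq
... | inj₁ i = inj₁ (sym (splitAt⁻¹-↑ˡ eq))
... | inj₂ i = inj₂ (sym (splitAt⁻¹-↑ʳ eq))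

simple : (k : ℕ) (R : Fin k → Fin k → Bool) → (∀ x y → R x y ≡ R y x) → Graph
simple k R R-sym = record
  { n = k ; adj = adjR ; sym = adjR-sym ; irrefl = adjR-irrefl }
  where
  adjR : Fin k → Fin k → Bool
  adjR x y = R x y ∧ not (x == y)

  adjR-sym : ∀ x y → adjR x y ≡ true → adjR y x ≡ true
  adjR-sym x y = subst (_≡ true) (cong₂ (λ a b → a ∧ not b) (R-sym x y) (==-sym {i = x} {y}))

  adjR-diagonal : ∀ x → adjR x x ≡ false
  adjR-diagonal x = trans (cong (λ b → R x x ∧ not b) (dec-true (x ≟ x) refl)) (∧-zeroʳ (R x x))

  adjR-irrefl : ∀ x → adjR x x ≡ true → ⊥
  adjR-irrefl x h with () ← trans (sym (adjR-diagonal x)) h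

-- Adjacency in a simple graph is R off the diagonal; these two lemmas are stated
-- for the unfolded adjacency R x y ∧ not (x == y).
simple-adj : {b : Bool} {x y : Fin k} → b ≡ true → x ≢ y → b ∧ not (x == y) ≡ true
simple-adj r x≢y = cong₂ (λ a b → a ∧ not b) r (dec-false (_ ≟ _) x≢y)

simple-rel : {b : Bool} {x y : Fin k} → b ∧ not (x == y) ≡ true → b ≡ true
simple-rel {b = b} = ∧-trueˡ b

-- Cones over a graph H

coneAdj : (H : Graph) → Fin (suc (n H)) → Fin (suc (n H)) → Bool
coneAdj H zero    zero    = false
coneAdj H zero    (suc _) = true
coneAdj H (suc _) zero    = true
coneAdj H (suc x) (suc y) = adj H x y

cone : Graph → Graph
cone H = record { n = suc (n H) ; adj = coneAdj H ; sym = cone-sym ; irrefl = cone-irrefl }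
  where
  cone-sym : ∀ u v → coneAdj H u v ≡ true → coneAdj H v u ≡ true
  cone-sym zero    (suc _) _ = refl
  cone-sym (suc _) zero    _ = refl
  cone-sym (suc x) (suc y) h = Graph.sym H x y h

  cone-irrefl : ∀ v → coneAdj H v v ≡ true → ⊥
  cone-irrefl (suc x) h = irrefl H x h

spoke : Fin k → Elem (suc k)
spoke x = edg zero (suc x)

baseClass : {X : Set} → (Fin k → X) → Fin (suc k) → List X
baseClass π zero    = []
baseClass π (suc y) = [ π y ]

coneTags : {X : Set} → (Fin k → X) → Elem (suc k) → List X
coneTags π (vtx _)   = []
coneTags π (edg _ q) = baseClass π q

module Cone (H : Graph) where

  connected : Connected (cone H)
  connected u v = to-apex u ▷ reverse (to-apex v)
    where
    to-apex : (u : Fin (n (cone H))) → Reachable (cone H) u zero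
    to-apex zero    = here
    to-apex (suc _) = step refl here

  γ : IsDomNum (cone H) V V 1
  γ = ([ vtx zero ] , (tt ∷ [] , [] ∷ []) , apex-dominates , refl)
    , λ _ _ → dominating-nonempty {x = vtx zero} tt
    where
    apex-dominates : Dominates (cone H) [ vtx zero ] V
    apex-dominates (vtx zero)    _ = inj₁ (here refl)
    apex-dominates (vtx (suc _)) _ = inj₂ (here refl)

  spoke-edge : (x : Fin (n H)) → InKind (cone H) E (spoke x)
  spoke-edge x = s≤s z≤n , refl

  spokes-subset : {S : List (Fin (n H))} → Unique S → IsSubsetOf (cone H) E (map spoke S)
  spokes-subset {S} unique =
    all-map⁺ (All.universal spoke-edge S) , unique-map⁺ (λ { refl → refl }) unique

  -- The spokes to a vertex cover S of H dominate all edges of the cone (S must be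
  -- nonempty as soon as H has a vertex, to reach the edges at the apex).
  spokes-dominate-E : (S : List (Fin (n H))) → (Fin (n H) → ∃ (_∈ S)) →
    (∀ x y → adj H x y ≡ true → x ∈ S ⊎ y ∈ S) → Dominates (cone H) (map spoke S) E
  spokes-dominate-E S nonempty cover (edg zero (suc y)) _ with nonempty y
  ... | s , s∈S = dominated-by (cone H) (∈-map⁺ spoke s∈S) (λ ne → ne , inj₁ refl)
  spokes-dominate-E S nonempty cover (edg (suc x) (suc y)) (_ , xy) with cover x y xy
  ... | inj₁ x∈S =
    dominated-by (cone H) (∈-map⁺ spoke x∈S) (λ ne → ne , inj₂ (inj₂ (inj₁ refl)))
  ... | inj₂ y∈S =
    dominated-by (cone H) (∈-map⁺ spoke y∈S) (λ ne → ne , inj₂ (inj₂ (inj₂ refl)))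

  spokes-dominate-V : (S : List (Fin (n H))) → (∀ x → x ∈ S) → Fin (n H) →
    Dominates (cone H) (map spoke S) V
  spokes-dominate-V S all x₀ (vtx zero)    _ = inj₂ (lose (∈-map⁺ spoke (all x₀)) (inj₁ refl))
  spokes-dominate-V S all x₀ (vtx (suc x)) _ = inj₂ (lose (∈-map⁺ spoke (all x)) (inj₂ refl))

  coneTags-few : {X : Set} (π : Fin (n H) → X) →
    ∀ a → InKind (cone H) E a → length (coneTags π a) ≤ 1
  coneTags-few π (edg _ zero)    _ = z≤n
  coneTags-few π (edg _ (suc _)) _ = s≤s z≤n

  cone-edge-class : {X : Set} (π : Fin (n H) → X) → (∀ x y → adj H x y ≡ true → π x ≡ π y) →
    ∀ {p q x} → IsEdge (cone H) p q → p ≡ suc x ⊎ q ≡ suc x → π x ∈ baseClass π q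
  cone-edge-class π respects             _         (inj₂ refl) = here refl
  cone-edge-class π respects {q = zero}  (() , _)  (inj₁ refl)
  cone-edge-class π respects {q = suc y} (_ , xy)  (inj₁ refl) = here (respects _ y xy)

-- The friendship graph: a cone over the perfect matching {left i, right i}

-- The perfect matching on Fin (m + m): left i is joined to right i.
matching : ℕ → Graph
matching m = simple (m + m) (λ x y → half m x == half m y) (λ x y → ==-sym {i = half m x} {half m y})

matching-same-half : (x y : Fin (m + m)) → adj (matching m) x y ≡ true → half m x ≡ half m y
matching-same-half x y h = ==-sound (simple-rel {x = x} {y} h)

matched : (i : Fin m) → adj (matching m) (left i) (right i) ≡ true
matched i = simple-adj (dec-true (_ ≟ _) (trans (half-left i) (sym (half-right i)))) (left≢right i i)

left-cover : (x y : Fin (m + m)) → adj (matching m) x y ≡ true →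
  x ∈ tabulate (left {m}) ⊎ y ∈ tabulate (left {m})
left-cover {m} x y h with left-or-right m x | left-or-right m y
... | inj₁ x≡ | _      = inj₁ (subst (_∈ _) (sym x≡) (∈-tabulate⁺ (half m x)))
... | inj₂ _  | inj₁ y≡ = inj₂ (subst (_∈ _) (sym y≡) (∈-tabulate⁺ (half m y)))
... | inj₂ x≡ | inj₂ y≡ = ⊥-elim (adjacent-distinct {G = matching m} h
  (trans x≡ (trans (cong (right {m}) (matching-same-half x y h)) (sym y≡))))

friendship : ℕ → Graph
friendship m = cone (matching m)

module Friendship (m : ℕ) where
  open Cone (matching m)

  -- Tag i: the base edge of the i-th triangle, dominated only by edges of that triangle.
  tagging : Tagging (friendship m) E E m 1
  tagging = record
    { target   = λ i → edg (suc (left i)) (suc (right i))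
    ; target∈W = λ i → s≤s (left<right i i) , matched i
    ; tags     = coneTags (half m)
    ; few-tags = coneTags-few (half m)
    ; tagged   = tagged
    }
    where
    tagged : ∀ i a → InKind (friendship m) E a →
      Covers (friendship m) a (edg (suc (left i)) (suc (right i))) → i ∈ coneTags (half m) a
    tagged i (edg p q) _  (inj₁ refl)        = here (sym (half-right i))
    tagged i (edg p q) pq (inj₂ (_ , shared)) = meets-triangle shared
      where
      via : (x : Fin (m + m)) → half m x ≡ i → p ≡ suc x ⊎ q ≡ suc x → i ∈ baseClass (half m) q
      via x eq meets = subst (_∈ _) eq (cone-edge-class (half m) matching-same-half pq meets)

      meets-triangle : (p ≡ suc (left i)) ⊎ (p ≡ suc (right i)) ⊎ (q ≡ suc (left i)) ⊎ (q ≡ suc (right i)) →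
        i ∈ baseClass (half m) q
      meets-triangle (inj₁ e)               = via (left i) (half-left i) (inj₁ e)
      meets-triangle (inj₂ (inj₁ e))        = via (right i) (half-right i) (inj₁ e)
      meets-triangle (inj₂ (inj₂ (inj₁ e))) = via (left i) (half-left i) (inj₂ e)
      meets-triangle (inj₂ (inj₂ (inj₂ e))) = via (right i) (half-right i) (inj₂ e)

  lefts : List (Fin (m + m))
  lefts = tabulate (left {m})

  γ' : IsDomNum (friendship m) E E m
  γ' = ( map spoke lefts
       , spokes-subset (unique-tabulate⁺ {f = left {m}} (↑ˡ-injective m _ _))
       , spokes-dominate-E lefts (λ y → _ , ∈-tabulate⁺ (half m y)) (left-cover {m})
       , trans (length-map spoke lefts) (length-tabulate (left {m})) )
     , tagging-bound₁ tagging

-- The star: a cone over the edgeless graph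

edgeless : ℕ → Graph
edgeless k = simple k (λ _ _ → false) (λ _ _ → refl)

star : ℕ → Graph
star k = cone (edgeless k)

module Star (k : ℕ) where
  open Cone (edgeless (suc k))

  -- Every edge of a star contains the apex.
  γVE : IsDomNum (star (suc k)) V E 1
  γVE = ([ vtx zero ] , (tt ∷ [] , [] ∷ []) , apex-dominates , refl)
      , λ _ _ → dominating-nonempty {x = spoke zero} (spoke-edge zero)
    where
    apex-dominates : Dominates (star (suc k)) [ vtx zero ] E
    apex-dominates (edg zero _)          _        = inj₂ (here (inj₁ refl))
    apex-dominates (edg (suc _) zero)    (() , _)
    apex-dominates (edg (suc _) (suc _)) (_ , ())

  -- Tag i: the i-th leaf, dominated only by its own spoke.
  tagging : Tagging (star (suc k)) E V (suc k) 1
  tagging = record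
    { target   = λ i → vtx (suc i)
    ; target∈W = λ _ → tt
    ; tags     = coneTags id
    ; few-tags = coneTags-few id
    ; tagged   = tagged
    }
    where
    tagged : ∀ i a → InKind (star (suc k)) E a → Covers (star (suc k)) a (vtx (suc i)) →
      i ∈ coneTags id a
    tagged i (edg p q) pq (inj₂ meets) = cone-edge-class id (λ _ _ ()) pq (Sum.map sym sym meets)

  γEV : IsDomNum (star (suc k)) E V (suc k)
  γEV = ( map spoke (allFin (suc k))
        , spokes-subset (unique-allFin⁺ (suc k))
        , spokes-dominate-V (allFin (suc k)) ∈-allFin zero
        , trans (length-map spoke (allFin (suc k))) (length-tabulate id) )
      , tagging-bound₁ tagging

-- Complete graphs

complete : ℕ → Graph
complete k = simple k (λ _ _ → true) (λ _ _ → refl)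

complete-adj : {x y : Fin k} → x ≢ y → adj (complete k) x y ≡ true
complete-adj = simple-adj refl

complete-connected : Connected (complete k)
complete-connected u v with u ≟ v
... | yes refl = here
... | no u≢v   = step (complete-adj u≢v) here

-- A vertex cover of K_{k+1} misses at most one vertex, so it has at least k elements.
complete-cover-bound : ∀ A → IsSubsetOf (complete (suc k)) V A →
  Dominates (complete (suc k)) A E → k ≤ length A
complete-cover-bound {k} A (A⊆V , _) dom with all? (λ j → vtx j ∈ᴱ? A)
... | yes all-in = ≤-trans (n≤1+n k) (injection-into-list vtx vtx-injective all-in)
... | no ¬all-in with ¬∀⟶∃¬ (suc k) _ (λ j → vtx j ∈ᴱ? A) ¬all-in
... | j , j∉A = injection-into-list (vtx ∘ punchIn j)
                  (punchIn-injective j _ _ ∘ vtx-injective)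
                  (λ i → [ id , ⊥-elim ∘ j∉A ]′ (cover-pair (punchInᵢ≢i j i)))
  where
  endpoint-in : ∀ {p q} → toℕ p < toℕ q → vtx p ∈ A ⊎ vtx q ∈ A
  endpoint-in {p} {q} p<q with dominator {x = edg p q} dom (p<q , complete-adj (<⇒≢ᶠ p<q))
  ... | vtx w   , w∈A , inj₂ (inj₁ refl) = inj₁ w∈A
  ... | vtx w   , w∈A , inj₂ (inj₂ refl) = inj₂ w∈A
  ... | edg _ _ , e∈A , _                = ⊥-elim (All.lookup A⊆V e∈A)

  cover-pair : ∀ {u v} → u ≢ v → vtx u ∈ A ⊎ vtx v ∈ A
  cover-pair {u} {v} u≢v with <-cmp u v
  ... | tri< u<v _ _ = endpoint-in u<v
  ... | tri≈ _ u≡v _ = ⊥-elim (u≢v u≡v)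
  ... | tri> _ _ v<u = Sum.swap (endpoint-in v<u)

complete-γVE : IsDomNum (complete (suc k)) V E k
complete-γVE {k} =
  ( tabulate (vtx ∘ suc)
  , (all-tabulate⁺ (λ _ → tt) , unique-tabulate⁺ (λ { refl → refl }))
  , all-but-zero
  , length-tabulate (vtx ∘ suc) )
  , complete-cover-bound
  where
  all-but-zero : Dominates (complete (suc k)) (tabulate (vtx ∘ suc)) E
  all-but-zero (edg p zero)    (() , _)
  all-but-zero (edg p (suc y)) _        = inj₂ (lose (∈-tabulate⁺ y) (inj₂ refl))

-- γ_{E,V}(K_{2m}) = m: a perfect matching is a minimum edge cover.
complete-γEV : IsDomNum (complete (m + m)) E V m
complete-γEV {m} =
  ( tabulate pair
  , (all-tabulate⁺ (λ i → left<right i i , complete-adj (left≢right i i))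
    , unique-tabulate⁺ (λ same → ↑ˡ-injective m _ _ (proj₁ (edg-injective same))))
  , perfect
  , length-tabulate pair )
  , λ A sub dom → halve (tagging-bound tagging A sub dom)
  where
  pair : Fin m → Elem (m + m)
  pair i = edg (left i) (right i)

  perfect : Dominates (complete (m + m)) (tabulate pair) V
  perfect (vtx x) _ = inj₂ (lose (∈-tabulate⁺ (half m x)) (left-or-right m x))

  -- Tag v: the vertex v, dominated only by edges at v.
  tagging : Tagging (complete (m + m)) E V (m + m) 2
  tagging = record
    { target   = vtx
    ; target∈W = λ _ → tt
    ; tags     = endpoints
    ; few-tags = λ { (edg _ _) _ → ≤-refl }
    ; tagged   = λ { _ (edg _ _) _ (inj₂ (inj₁ refl)) → here refl
                   ; _ (edg _ _) _ (inj₂ (inj₂ refl)) → there (here refl) }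
    }

-- The corona of the clique K_N (N = 2k): clique vertices left c, and a pendant
-- vertex right c attached to each left c

module Corona (k : ℕ) where

  -- The clique has N = 2k vertices, so that it has a perfect matching.
  N : ℕ
  N = k + k

  related : Fin (N + N) → Fin (N + N) → Bool
  related x y = (isLeft N x ∧ isLeft N y) ∨ (half N x == half N y)

  corona : Graph
  corona = simple (N + N) related
    (λ x y → cong₂ _∨_ (∧-comm (isLeft N x) (isLeft N y)) (==-sym {i = half N x} {half N y}))

  clique-adj : {i j : Fin N} → i ≢ j → adj corona (left i) (left j) ≡ true
  clique-adj {i} {j} i≢j = simple-adj
    (cong₂ (λ a b → (a ∧ b) ∨ (half N (left i) == half N (left j))) (isLeft-left i) (isLeft-left j))
    (i≢j ∘ ↑ˡ-injective N i j)

  pendant-adj : (i : Fin N) → adj corona (left i) (right i) ≡ true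
  pendant-adj i = simple-adj
    (trans (cong ((isLeft N (left i) ∧ isLeft N (right i)) ∨_)
                 (dec-true (_ ≟ _) (trans (half-left i) (sym (half-right i)))))
           (∨-zeroʳ _))
    (left≢right i i)

  pendant-neighbour : {u : Fin (N + N)} {i : Fin N} → adj corona u (right i) ≡ true → half N u ≡ i
  pendant-neighbour {u} {i} h = trans (==-sound same-half) (half-right i)
    where
    same-half : (half N u == half N (right i)) ≡ true
    same-half = begin
      half N u == half N (right i)
        ≡⟨ cong (_∨ (half N u == half N (right i))) (sym (∧-zeroʳ (isLeft N u))) ⟩
      (isLeft N u ∧ false) ∨ (half N u == half N (right i))
        ≡⟨ cong (λ b → (isLeft N u ∧ b) ∨ (half N u == half N (right i))) (sym (isLeft-right i)) ⟩
      related u (right i)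
        ≡⟨ simple-rel {x = u} {right i} h ⟩
      true ∎
      where open ≡-Reasoning

  -- Pendant vertices are pairwise nonadjacent, so every edge meets the clique.
  clique-endpoint : {p q : Fin (N + N)} → adj corona p q ≡ true →
    ∃ λ (c : Fin N) → p ≡ left c ⊎ q ≡ left c
  clique-endpoint {p} {q} h with left-or-right N p | left-or-right N q
  ... | inj₁ p≡ | _       = half N p , inj₁ p≡
  ... | inj₂ _  | inj₁ q≡ = half N q , inj₂ q≡
  ... | inj₂ p≡ | inj₂ q≡ = ⊥-elim (adjacent-distinct {G = corona} h
    (trans p≡ (trans (cong (right {N}) same-index) (sym q≡))))
    where
    same-index : half N p ≡ half N q
    same-index = pendant-neighbour (subst (λ z → adj corona p z ≡ true) q≡ h)

  nontrivial : 1 ≤ k → Nontrivial corona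
  nontrivial 1≤k = +-mono-≤ 1≤N 1≤N
    where
    1≤N : 1 ≤ N
    1≤N = ≤-trans 1≤k (m≤m+n k k)

  connected : Connected corona
  connected u v = to-clique u ▷ (clique-reach _ _ ▷ reverse (to-clique v))
    where
    to-clique : (u : Fin (N + N)) → Reachable corona u (left (half N u))
    to-clique u with left-or-right N u
    ... | inj₁ u≡ = subst (λ z → Reachable corona z (left (half N u))) (sym u≡) here
    ... | inj₂ u≡ = subst (λ z → Reachable corona z (left (half N u))) (sym u≡)
                      (step (Graph.sym corona _ _ (pendant-adj (half N u))) here)

    clique-reach : (i j : Fin N) → Reachable corona (left i) (left j)
    clique-reach i j with i ≟ j
    ... | yes refl = here
    ... | no i≢j   = step (clique-adj i≢j) here

  clique : List (Elem (N + N))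
  clique = tabulate (vtx ∘ left {N})

  -- γ = N: the clique dominates; each pendant vertex needs its own dominator.
  γ : IsDomNum corona V V N
  γ = ( clique
      , (all-tabulate⁺ (λ _ → tt) , unique-tabulate⁺ (↑ˡ-injective N _ _ ∘ vtx-injective))
      , clique-dominates
      , length-tabulate (vtx ∘ left {N}) )
    , tagging-bound₁ tagging
    where
    clique-dominates : Dominates corona clique V
    clique-dominates (vtx x) _ with left-or-right N x
    ... | inj₁ x≡ = inj₁ (subst (λ z → vtx z ∈ clique) (sym x≡) (∈-tabulate⁺ (half N x)))
    ... | inj₂ x≡ = inj₂ (lose (∈-tabulate⁺ (half N x))
                          (subst (λ z → adj corona (left (half N x)) z ≡ true) (sym x≡) (pendant-adj _)))

    tagging : Tagging corona V V N 1
    tagging = record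
      { target   = λ i → vtx (right i)
      ; target∈W = λ _ → tt
      ; tags     = map (half N) ∘ endpoints
      ; few-tags = λ { (vtx _) _ → ≤-refl }
      ; tagged   = λ { i (vtx _) _ (inj₁ refl) → here (sym (half-right i))
                     ; i (vtx _) _ (inj₂ h)    → here (sym (pendant-neighbour h)) }
      }

  -- γ' = k: a perfect matching of the clique dominates all edges; each pendant edge
  -- needs a dominator at one of its two endpoints.
  cliquePair : Fin k → Elem (N + N)
  cliquePair j = edg (left (left j)) (left (right j))

  on-cliquePair : (c : Fin N) → left (left (half k c)) ≡ left c ⊎ left (right (half k c)) ≡ left c
  on-cliquePair c = Sum.map (λ c≡ → cong (left {N}) (sym c≡)) (λ c≡ → cong (left {N}) (sym c≡)) (left-or-right k c)

  cliquePair-edge : (j : Fin k) → InKind corona E (cliquePair j)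
  cliquePair-edge j =
    subst₂ _<_ (sym (toℕ-↑ˡ (left j) N)) (sym (toℕ-↑ˡ (right j) N)) (left<right j j) ,
    clique-adj (left≢right j j)

  γ' : IsDomNum corona E E k
  γ' = ( tabulate cliquePair
       , (all-tabulate⁺ cliquePair-edge
         , unique-tabulate⁺ (λ same → ↑ˡ-injective k _ _ (↑ˡ-injective N _ _ (proj₁ (edg-injective same)))))
       , pairs-dominate
       , length-tabulate cliquePair )
     , λ A sub dom → halve (tagging-bound tagging A sub dom)
    where
    pairs-dominate : Dominates corona (tabulate cliquePair) E
    pairs-dominate (edg p q) (_ , pq) with clique-endpoint pq
    ... | c , meets = dominated-by corona (∈-tabulate⁺ (half k c))
                        (λ ne → ne , share-endpoint (on-cliquePair c) meets)

    tagging : Tagging corona E E N 2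
    tagging = record
      { target   = λ i → edg (left i) (right i)
      ; target∈W = λ i → left<right i i , pendant-adj i
      ; tags     = map (half N) ∘ endpoints
      ; few-tags = λ { (edg _ _) _ → ≤-refl }
      ; tagged   = λ
        { i (edg _ _) _ (inj₁ refl)                          → here (sym (half-left i))
        ; i (edg _ _) _ (inj₂ (_ , inj₁ refl))               → here (sym (half-left i))
        ; i (edg _ _) _ (inj₂ (_ , inj₂ (inj₁ refl)))        → here (sym (half-right i))
        ; i (edg _ _) _ (inj₂ (_ , inj₂ (inj₂ (inj₁ refl)))) → there (here (sym (half-left i)))
        ; i (edg _ _) _ (inj₂ (_ , inj₂ (inj₂ (inj₂ refl)))) → there (here (sym (half-right i))) }
      }

theorem3 : (r : ℕ) → 1 ≤ r →
    (Σ Graph λ G → Nontrivial G × Connected G × Σ ℕ λ a → Σ ℕ λ b →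
       IsDomNum G V V a × IsDomNum G E E b × a + r < b)
    × (Σ Graph λ G → Nontrivial G × Connected G × Σ ℕ λ a → Σ ℕ λ b →
       IsDomNum G V V a × IsDomNum G E E b × b + r < a)
    × (Σ Graph λ G → Nontrivial G × Connected G × Σ ℕ λ a → Σ ℕ λ b →
       IsDomNum G V E a × IsDomNum G E V b × b + r < a)
    × (Σ Graph λ G → Nontrivial G × Connected G × Σ ℕ λ a → Σ ℕ λ b →
       IsDomNum G V E a × IsDomNum G E V b × a + r < b)
theorem3 r _ =
    ( friendship r+2 , s≤s (s≤s z≤n) , Cone.connected (matching r+2)
    , 1 , r+2 , Cone.γ (matching r+2) , Friendship.γ' r+2 , ≤-refl )
  , ( Corona.corona r+1 , Corona.nontrivial r+1 (s≤s z≤n) , Corona.connected r+1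
    , r+1 + r+1 , r+1 , Corona.γ r+1 , Corona.γ' r+1 , +-monoʳ-< r+1 (n<1+n r) )
  , ( complete (r+2 + r+2) , s≤s (s≤s z≤n) , complete-connected
    , r+1 + r+2 , r+2 , complete-γVE , complete-γEV , ≤-reflexive arithmetic )
  , ( star r+2 , s≤s (s≤s z≤n) , Cone.connected (edgeless r+2)
    , 1 , r+2 , Star.γVE (suc r) , Star.γEV (suc r) , ≤-refl )
  where
  r+1 r+2 : ℕ
  r+1 = suc r
  r+2 = suc (suc r)

  -- (r + 2) + r + 1 = (r + 1) + (r + 2), i.e. (r + 2) + r < 2r + 3
  arithmetic : suc (r+2 + r) ≡ r+1 + r+2
  arithmetic = cong suc (sym (trans (+-suc r (suc r)) (cong suc (+-suc r r))))
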